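{- Let $n$ be any non-zero integer, and let $n-n$ denote the disjunctive sum $n+(-n)$ of the canonical forms of $n$ and $-n$. Then $n+(-n)\triangleq 1+(-1)\cong\{ -1\mid 1\}$.
   Context: Games are short normal-play combinatorial games $G\cong\{L(G)\mid R(G)\}$ ($\cong$ = identical literal form). Canonical forms of integers: $0\cong\{\mid\}$, $n+1\cong\{n\mid\}$ for $n\ge0$, and $-n\cong\{\mid -n+1\}$ for $n\ge1$. Disjunctive sum $G+H\cong\{G^L+H,G+H^L\mid G^R+H,G+H^R\}$, negation $-G\cong\{ -R(G)\mid-L(G)\}$. $G\triangleq H$ (equivalence modulo domination) means that in $G+(-H)$, for every first move by either player in either summand, the other player has a winning response made in the other summand. -}

module Defs where

open import Data.List using (List; []; _∷_; _++_)
open import Data.List.Membership.Propositional using (_∈_)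
open import Data.Product using (_×_; _,_; Σ-syntax)
open import Data.Sum using (_⊎_)
open import Data.Empty using (⊥)
open import Data.Unit using (⊤)
open import Data.Nat using (ℕ; zero; suc)
open import Data.Integer using (ℤ; +_; -[1+_])

-- Short games in literal form G ≅ { L(G) | R(G) }; option lists are literal
-- (ordered) lists, and "identical literal form" (≅) is propositional equality ≡.
data Game : Set where
  ⟨_∣_⟩ : List Game → List Game → Game

L : Game → List Game
L ⟨ l ∣ r ⟩ = l

R : Game → List Game
R ⟨ l ∣ r ⟩ = r

mutual
  neg : Game → Game
  neg ⟨ l ∣ r ⟩ = ⟨ negs r ∣ negs l ⟩

  negs : List Game → List Game
  negs [] = []
  negs (g ∷ gs) = neg g ∷ negs gs

mutual
  infixl 6 _⊕_
  _⊕_ : Game → Game → Game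
  ⟨ gl ∣ gr ⟩ ⊕ ⟨ hl ∣ hr ⟩ =
    ⟨ addˡ gl ⟨ hl ∣ hr ⟩ ++ addʳ ⟨ gl ∣ gr ⟩ hl
    ∣ addˡ gr ⟨ hl ∣ hr ⟩ ++ addʳ ⟨ gl ∣ gr ⟩ hr ⟩

  addˡ : List Game → Game → List Game
  addˡ [] h = []
  addˡ (g ∷ gs) h = (g ⊕ h) ∷ addˡ gs h

  addʳ : Game → List Game → List Game
  addʳ g [] = []
  addʳ g (h ∷ hs) = (g ⊕ h) ∷ addʳ g hs

natG : ℕ → Game
natG zero = ⟨ [] ∣ [] ⟩
natG (suc n) = ⟨ natG n ∷ [] ∣ [] ⟩

negNatG : ℕ → Game   -- negNatG n is the canonical form of -n
negNatG zero = ⟨ [] ∣ [] ⟩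
negNatG (suc n) = ⟨ [] ∣ negNatG n ∷ [] ⟩

intG : ℤ → Game
intG (+ n) = natG n
intG -[1+ n ] = negNatG (suc n)

-- Normal play outcomes.
-- LeftWins₁ G : Left, moving first in G, wins.
-- LeftWins₂ G : Left wins when Right moves first in G.
-- (and symmetrically for Right)
mutual
  LeftWins₁ : Game → Set
  LeftWins₁ ⟨ l ∣ r ⟩ = SomeLW₂ l

  LeftWins₂ : Game → Set
  LeftWins₂ ⟨ l ∣ r ⟩ = AllLW₁ r

  SomeLW₂ : List Game → Set
  SomeLW₂ [] = ⊥
  SomeLW₂ (g ∷ gs) = LeftWins₂ g ⊎ SomeLW₂ gs

  AllLW₁ : List Game → Set
  AllLW₁ [] = ⊤
  AllLW₁ (g ∷ gs) = LeftWins₁ g × AllLW₁ gs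

mutual
  RightWins₁ : Game → Set
  RightWins₁ ⟨ l ∣ r ⟩ = SomeRW₂ r

  RightWins₂ : Game → Set
  RightWins₂ ⟨ l ∣ r ⟩ = AllRW₁ l

  SomeRW₂ : List Game → Set
  SomeRW₂ [] = ⊥
  SomeRW₂ (g ∷ gs) = RightWins₂ g ⊎ SomeRW₂ gs

  AllRW₁ : List Game → Set
  AllRW₁ [] = ⊤
  AllRW₁ (g ∷ gs) = RightWins₁ g × AllRW₁ gs

-- Equivalence modulo domination G ≜ H: in G + (-H), for every first move by
-- either player in either summand, the other player has a winning response
-- (i.e. one after which they win with the opponent to move) in the other summand.
infix 4 _≜_
_≜_ : Game → Game → Set
G ≜ H =
  (∀ {a} → a ∈ L G → Σ[ b ∈ Game ] (b ∈ R (neg H) × RightWins₂ (a ⊕ b)))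
  × (∀ {b} → b ∈ L (neg H) → Σ[ a ∈ Game ] (a ∈ R G × RightWins₂ (a ⊕ b)))
  × (∀ {a} → a ∈ R G → Σ[ b ∈ Game ] (b ∈ L (neg H) × LeftWins₂ (a ⊕ b)))
  × (∀ {b} → b ∈ R (neg H) → Σ[ a ∈ Game ] (a ∈ L G × LeftWins₂ (a ⊕ b)))

-- Say G is l/r-free when Left has exactly l moves at his disposal and Right
-- exactly r, each move using up one of the mover's own.  The integer k ≥ 0 is
-- k/0-free and −k is 0/k-free, freeness adds up under disjunctive sum, and in
-- an l/r-free game the player with more free moves wins, while with equal
-- counts the player to move loses.  So n + (−n) is k/k-free with k = |n| > 0.
-- In n + (−n) + {−1 ∣ 1} (note −{−1 ∣ 1} = {−1 ∣ 1}) every opening move puts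
-- the opener one free move behind; the opponent levels the counts by a move in
-- the other summand (spending one of his own in n + (−n), or handing the opener
-- one back in {−1 ∣ 1}), and the opener is left to move in a level position.
module Submission where

open import Defs
open import Data.List using (List; []; _∷_; _++_; map)
open import Data.List.Membership.Propositional using (_∈_)
open import Data.List.Membership.Propositional.Properties
  using (∈-++⁻; ∈-++⁺ˡ; ∈-++⁺ʳ; ∈-map⁻; ∈-map⁺)
open import Data.List.Relation.Unary.Any using (here; there)
open import Data.Product using (_×_; _,_; ∃-syntax)
open import Data.Sum using (_⊎_; inj₁; inj₂)
open import Data.Unit using (tt)
open import Data.Nat using (ℕ; zero; suc; pred; _+_; _≤_; _<_; s≤s; z≤n)
open import Data.Nat.Properties
  using (+-suc; +-comm; +-identityʳ; ≤-reflexive; m≤n⇒m≤n+o; m≤n⇒m≤o+n; n≢0⇒n>0)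
open import Data.Integer as ℤ using (ℤ; -[1+_]; -_; ∣_∣; -1ℤ; 1ℤ; 0ℤ)
open import Data.Integer.Properties using (∣i∣≡0⇒i≡0)
open import Function using (_∘_)
open import Relation.Binary.PropositionalEquality
  using (_≡_; _≢_; refl; sym; trans; cong; cong₂; subst)

∈-++-map⁻ : ∀ {A B : Set} {f g : A → B} (xs ys : List A) {b : B} →
  b ∈ map f xs ++ map g ys →
  (∃[ x ] (x ∈ xs × b ≡ f x)) ⊎ (∃[ y ] (y ∈ ys × b ≡ g y))
∈-++-map⁻ {f = f} xs ys b∈ with ∈-++⁻ (map f xs) b∈
... | inj₁ b∈ˡ = inj₁ (∈-map⁻ f b∈ˡ)
... | inj₂ b∈ʳ = inj₂ (∈-map⁻ _ b∈ʳ)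

m+n>0⇒m>0⊎n>0 : ∀ m {n} → 0 < m + n → 0 < m ⊎ 0 < n
m+n>0⇒m>0⊎n>0 zero    0<n = inj₂ 0<n
m+n>0⇒m>0⊎n>0 (suc m) _   = inj₁ (s≤s z≤n)

m>0∧m≤n⇒pred[m]<n : ∀ {m n} → 0 < m → m ≤ n → pred m < n
m>0∧m≤n⇒pred[m]<n (s≤s z≤n) m≤n = m≤n

addˡ-map : ∀ gs H → addˡ gs H ≡ map (_⊕ H) gs
addˡ-map []       H = refl
addˡ-map (g ∷ gs) H = cong (g ⊕ H ∷_) (addˡ-map gs H)

addʳ-map : ∀ G hs → addʳ G hs ≡ map (G ⊕_) hs
addʳ-map G []       = refl
addʳ-map G (h ∷ hs) = cong (G ⊕ h ∷_) (addʳ-map G hs)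

L-⊕ : ∀ G H → L (G ⊕ H) ≡ map (_⊕ H) (L G) ++ map (G ⊕_) (L H)
L-⊕ ⟨ gl ∣ gr ⟩ ⟨ hl ∣ hr ⟩ = cong₂ _++_ (addˡ-map gl _) (addʳ-map _ hl)

R-⊕ : ∀ G H → R (G ⊕ H) ≡ map (_⊕ H) (R G) ++ map (G ⊕_) (R H)
R-⊕ ⟨ gl ∣ gr ⟩ ⟨ hl ∣ hr ⟩ = cong₂ _++_ (addˡ-map gr _) (addʳ-map _ hr)

L-⊕⁻ : ∀ G H {K} → K ∈ L (G ⊕ H) →
  (∃[ G' ] (G' ∈ L G × K ≡ G' ⊕ H)) ⊎ (∃[ H' ] (H' ∈ L H × K ≡ G ⊕ H'))
L-⊕⁻ G H K∈ = ∈-++-map⁻ (L G) (L H) (subst (_ ∈_) (L-⊕ G H) K∈)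

R-⊕⁻ : ∀ G H {K} → K ∈ R (G ⊕ H) →
  (∃[ G' ] (G' ∈ R G × K ≡ G' ⊕ H)) ⊎ (∃[ H' ] (H' ∈ R H × K ≡ G ⊕ H'))
R-⊕⁻ G H K∈ = ∈-++-map⁻ (R G) (R H) (subst (_ ∈_) (R-⊕ G H) K∈)

L-⊕⁺ˡ : ∀ G H {G'} → G' ∈ L G → G' ⊕ H ∈ L (G ⊕ H)
L-⊕⁺ˡ G H G'∈ = subst (_ ∈_) (sym (L-⊕ G H)) (∈-++⁺ˡ (∈-map⁺ _ G'∈))

L-⊕⁺ʳ : ∀ G H {H'} → H' ∈ L H → G ⊕ H' ∈ L (G ⊕ H)
L-⊕⁺ʳ G H H'∈ = subst (_ ∈_) (sym (L-⊕ G H)) (∈-++⁺ʳ _ (∈-map⁺ _ H'∈))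

R-⊕⁺ˡ : ∀ G H {G'} → G' ∈ R G → G' ⊕ H ∈ R (G ⊕ H)
R-⊕⁺ˡ G H G'∈ = subst (_ ∈_) (sym (R-⊕ G H)) (∈-++⁺ˡ (∈-map⁺ _ G'∈))

R-⊕⁺ʳ : ∀ G H {H'} → H' ∈ R H → G ⊕ H' ∈ R (G ⊕ H)
R-⊕⁺ʳ G H H'∈ = subst (_ ∈_) (sym (R-⊕ G H)) (∈-++⁺ʳ _ (∈-map⁺ _ H'∈))

RightWins₂-intro : ∀ G → (∀ {G'} → G' ∈ L G → RightWins₁ G') → RightWins₂ G
RightWins₂-intro ⟨ l ∣ r ⟩ = all l
  where
  all : ∀ xs → (∀ {G'} → G' ∈ xs → RightWins₁ G') → AllRW₁ xs
  all []       w = tt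
  all (x ∷ xs) w = w (here refl) , all xs (λ G'∈ → w (there G'∈))

LeftWins₂-intro : ∀ G → (∀ {G'} → G' ∈ R G → LeftWins₁ G') → LeftWins₂ G
LeftWins₂-intro ⟨ l ∣ r ⟩ = all r
  where
  all : ∀ xs → (∀ {G'} → G' ∈ xs → LeftWins₁ G') → AllLW₁ xs
  all []       w = tt
  all (x ∷ xs) w = w (here refl) , all xs (λ G'∈ → w (there G'∈))

RightWins₁-intro : ∀ G {G'} → G' ∈ R G → RightWins₂ G' → RightWins₁ G
RightWins₁-intro ⟨ l ∣ r ⟩ = any r
  where
  any : ∀ xs {G'} → G' ∈ xs → RightWins₂ G' → SomeRW₂ xs
  any (x ∷ xs) (here refl) w = inj₁ w
  any (x ∷ xs) (there G'∈) w = inj₂ (any xs G'∈ w)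

LeftWins₁-intro : ∀ G {G'} → G' ∈ L G → LeftWins₂ G' → LeftWins₁ G
LeftWins₁-intro ⟨ l ∣ r ⟩ = any l
  where
  any : ∀ xs {G'} → G' ∈ xs → LeftWins₂ G' → SomeLW₂ xs
  any (x ∷ xs) (here refl) w = inj₁ w
  any (x ∷ xs) (there G'∈) w = inj₂ (any xs G'∈ w)

record FreeMoves (G : Game) (l r : ℕ) : Set where
  inductive
  no-eta-equality
  pattern
  constructor free
  field
    left-positive   : ∀ {G'} → G' ∈ L G → 0 < l
    left-available  : 0 < l → ∃[ G' ] G' ∈ L G
    left-step       : ∀ {G'} → G' ∈ L G → FreeMoves G' (pred l) r
    right-positive  : ∀ {G'} → G' ∈ R G → 0 < r
    right-available : 0 < r → ∃[ G' ] G' ∈ R G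
    right-step      : ∀ {G'} → G' ∈ R G → FreeMoves G' l (pred r)

open FreeMoves

FreeMoves-natG : ∀ k → FreeMoves (natG k) k 0
FreeMoves-natG zero    = free (λ ()) (λ ()) (λ ()) (λ ()) (λ ()) (λ ())
FreeMoves-natG (suc k) =
  free (λ _ → s≤s z≤n) (λ _ → natG k , here refl)
       (λ { (here refl) → FreeMoves-natG k })
       (λ ()) (λ ()) (λ ())

FreeMoves-negNatG : ∀ k → FreeMoves (negNatG k) 0 k
FreeMoves-negNatG zero    = free (λ ()) (λ ()) (λ ()) (λ ()) (λ ()) (λ ())
FreeMoves-negNatG (suc k) =
  free (λ ()) (λ ()) (λ ())
       (λ _ → s≤s z≤n) (λ _ → negNatG k , here refl)
       (λ { (here refl) → FreeMoves-negNatG k })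

mutual
  FreeMoves-⊕ : ∀ {G H l r l' r'} → FreeMoves G l r → FreeMoves H l' r' →
    FreeMoves (G ⊕ H) (l + l') (r + r')
  FreeMoves-⊕ {G} {H} {l} {r} {l'} {r'} fG fH =
    free lpos lavail (λ K∈ → ⊕-left-step fG fH (L-⊕⁻ G H K∈))
         rpos ravail (λ K∈ → ⊕-right-step fG fH (R-⊕⁻ G H K∈))
    where
    lpos : ∀ {K} → K ∈ L (G ⊕ H) → 0 < l + l'
    lpos K∈ with L-⊕⁻ G H K∈
    ... | inj₁ (_ , G'∈ , _) = m≤n⇒m≤n+o l' (left-positive fG G'∈)
    ... | inj₂ (_ , H'∈ , _) = m≤n⇒m≤o+n l (left-positive fH H'∈)

    lavail : 0 < l + l' → ∃[ K ] K ∈ L (G ⊕ H)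
    lavail 0<l+l' with m+n>0⇒m>0⊎n>0 l 0<l+l'
    ... | inj₁ 0<l  = let G' , G'∈ = left-available fG 0<l  in G' ⊕ H , L-⊕⁺ˡ G H G'∈
    ... | inj₂ 0<l' = let H' , H'∈ = left-available fH 0<l' in G ⊕ H' , L-⊕⁺ʳ G H H'∈

    rpos : ∀ {K} → K ∈ R (G ⊕ H) → 0 < r + r'
    rpos K∈ with R-⊕⁻ G H K∈
    ... | inj₁ (_ , G'∈ , _) = m≤n⇒m≤n+o r' (right-positive fG G'∈)
    ... | inj₂ (_ , H'∈ , _) = m≤n⇒m≤o+n r (right-positive fH H'∈)

    ravail : 0 < r + r' → ∃[ K ] K ∈ R (G ⊕ H)
    ravail 0<r+r' with m+n>0⇒m>0⊎n>0 r 0<r+r'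
    ... | inj₁ 0<r  = let G' , G'∈ = right-available fG 0<r  in G' ⊕ H , R-⊕⁺ˡ G H G'∈
    ... | inj₂ 0<r' = let H' , H'∈ = right-available fH 0<r' in G ⊕ H' , R-⊕⁺ʳ G H H'∈

  ⊕-left-step : ∀ {G H l r l' r' K} → FreeMoves G l r → FreeMoves H l' r' →
    (∃[ G' ] (G' ∈ L G × K ≡ G' ⊕ H)) ⊎ (∃[ H' ] (H' ∈ L H × K ≡ G ⊕ H')) →
    FreeMoves K (pred (l + l')) (r + r')
  ⊕-left-step (free lpos _ lstep _ _ _) fH (inj₁ (_ , G'∈ , refl))
    with lpos G'∈
  ... | s≤s z≤n = FreeMoves-⊕ (lstep G'∈) fH
  ⊕-left-step {G} {l = l} {r} {r' = r'} fG (free lpos _ lstep _ _ _) (inj₂ (H' , H'∈ , refl))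
    with lpos H'∈
  ... | s≤s {n = l'} z≤n =
    subst (λ m → FreeMoves (G ⊕ H') m (r + r')) (cong pred (sym (+-suc l l')))
          (FreeMoves-⊕ fG (lstep H'∈))

  ⊕-right-step : ∀ {G H l r l' r' K} → FreeMoves G l r → FreeMoves H l' r' →
    (∃[ G' ] (G' ∈ R G × K ≡ G' ⊕ H)) ⊎ (∃[ H' ] (H' ∈ R H × K ≡ G ⊕ H')) →
    FreeMoves K (l + l') (pred (r + r'))
  ⊕-right-step (free _ _ _ rpos _ rstep) fH (inj₁ (_ , G'∈ , refl))
    with rpos G'∈
  ... | s≤s z≤n = FreeMoves-⊕ (rstep G'∈) fH
  ⊕-right-step {r = r} fG (free _ _ _ rpos _ rstep) (inj₂ (_ , H'∈ , refl))
    with rpos H'∈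
  ... | s≤s {n = r'} z≤n =
    subst (FreeMoves _ _) (cong pred (sym (+-suc r r'))) (FreeMoves-⊕ fG (rstep H'∈))

mutual
  right-wins₂ : ∀ {G l r} → FreeMoves G l r → l ≤ r → RightWins₂ G
  right-wins₂ {G} (free lpos _ lstep _ _ _) l≤r =
    RightWins₂-intro G λ G'∈ →
      right-wins₁ (lstep G'∈) (m>0∧m≤n⇒pred[m]<n (lpos G'∈) l≤r)

  right-wins₁ : ∀ {G l r} → FreeMoves G l r → l < r → RightWins₁ G
  right-wins₁ {G} (free _ _ _ _ ravail rstep) (s≤s l≤r) with ravail (s≤s z≤n)
  ... | G' , G'∈ = RightWins₁-intro G G'∈ (right-wins₂ (rstep G'∈) l≤r)

mutual
  left-wins₂ : ∀ {G l r} → FreeMoves G l r → r ≤ l → LeftWins₂ G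
  left-wins₂ {G} (free _ _ _ rpos _ rstep) r≤l =
    LeftWins₂-intro G λ G'∈ →
      left-wins₁ (rstep G'∈) (m>0∧m≤n⇒pred[m]<n (rpos G'∈) r≤l)

  left-wins₁ : ∀ {G l r} → FreeMoves G l r → r < l → LeftWins₁ G
  left-wins₁ {G} (free _ lavail lstep _ _ _) (s≤s r≤l) with lavail (s≤s z≤n)
  ... | G' , G'∈ = LeftWins₁-intro G G'∈ (left-wins₂ (lstep G'∈) r≤l)

±1 : Game
±1 = intG 1ℤ ⊕ intG -1ℤ

FreeMoves-balanced⇒≜±1 : ∀ {G l} → FreeMoves G l l → 0 < l → G ≜ ±1
FreeMoves-balanced⇒≜±1 {l = suc k} (free _ lavail lstep _ ravail rstep) _ =
  (λ G'∈ → natG 1 , here refl , right-wins₂ (⊕1 (lstep G'∈)) (≤-reflexive k+1≡suc[k]+0))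
  , (λ { (here refl) → let G' , G'∈ = ravail (s≤s z≤n) in
         G' , G'∈ , right-wins₂ (⊕-1 (rstep G'∈)) (≤-reflexive (sym k+1≡suc[k]+0)) })
  , (λ G'∈ → negNatG 1 , here refl , left-wins₂ (⊕-1 (rstep G'∈)) (≤-reflexive k+1≡suc[k]+0))
  , (λ { (here refl) → let G' , G'∈ = lavail (s≤s z≤n) in
         G' , G'∈ , left-wins₂ (⊕1 (lstep G'∈)) (≤-reflexive (sym k+1≡suc[k]+0)) })
  where
  ⊕1 : ∀ {G'} → FreeMoves G' k (suc k) → FreeMoves (G' ⊕ natG 1) (k + 1) (suc k + 0)
  ⊕1 fG' = FreeMoves-⊕ fG' (FreeMoves-natG 1)
  ⊕-1 : ∀ {G'} → FreeMoves G' (suc k) k → FreeMoves (G' ⊕ negNatG 1) (suc k + 0) (k + 1)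
  ⊕-1 fG' = FreeMoves-⊕ fG' (FreeMoves-negNatG 1)
  k+1≡suc[k]+0 : k + 1 ≡ suc k + 0
  k+1≡suc[k]+0 = trans (+-comm k 1) (sym (+-identityʳ (suc k)))

FreeMoves-n-n : ∀ n → FreeMoves (intG n ⊕ intG (- n)) ∣ n ∣ ∣ n ∣
FreeMoves-n-n (ℤ.+ zero) = FreeMoves-⊕ (FreeMoves-natG 0) (FreeMoves-natG 0)
FreeMoves-n-n (ℤ.+ suc k) =
  subst (λ l → FreeMoves (natG (suc k) ⊕ negNatG (suc k)) l (suc k)) (+-identityʳ (suc k))
        (FreeMoves-⊕ (FreeMoves-natG (suc k)) (FreeMoves-negNatG (suc k)))
FreeMoves-n-n -[1+ k ] =
  subst (FreeMoves (negNatG (suc k) ⊕ natG (suc k)) (suc k)) (+-identityʳ (suc k))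
        (FreeMoves-⊕ (FreeMoves-negNatG (suc k)) (FreeMoves-natG (suc k)))

lemma3p1 : (n : ℤ) → n ≢ 0ℤ →
    (intG n ⊕ intG (- n)) ≜ (intG 1ℤ ⊕ intG -1ℤ)
    × (intG 1ℤ ⊕ intG -1ℤ) ≡ ⟨ intG -1ℤ ∷ [] ∣ intG 1ℤ ∷ [] ⟩
lemma3p1 n n≢0 =
  FreeMoves-balanced⇒≜±1 (FreeMoves-n-n n) (n≢0⇒n>0 (n≢0 ∘ ∣i∣≡0⇒i≡0)) , refl
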